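{- There is an algorithm which, given any positive rational number $r$, decides in finitely many steps whether or not $r$ belongs to the Wooley semigroup $\mathcal{W}_0$, and, if it does, outputs an explicit representation of $r$ as a finite product of generators $g(n)=\frac{3n+2}{2n+1}$ (with repetitions allowed).
   Context: For integers $n\ge 0$ let $g(n)=\frac{3n+2}{2n+1}$. The Wooley semigroup $\mathcal{W}_0$ is the multiplicative semigroup generated by $\{g(n): n\ge 0\}=\{\frac{2}{1},\frac{5}{3},\frac{8}{5},\frac{11}{7},\dots\}$, i.e. the set of all finite (nonempty) products of these generators, repetitions allowed. -}

module Defs where

open import Data.Nat using (ℕ; suc; _+_; _*_)
open import Data.Integer using (+_)
open import Data.Rational using (ℚ; _/_; 1ℚ) renaming (_*_ to _*ℚ_)
open import Data.List using (List; foldr)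
open import Data.List.NonEmpty using (List⁺; _∷_)
open import Data.Product using (Σ)
open import Relation.Binary.PropositionalEquality using (_≡_)

g : ℕ → ℚ
g n = + (3 * n + 2) / suc (2 * n)

prodG : List⁺ ℕ → ℚ
prodG (n ∷ ns) = g n *ℚ foldr (λ m acc → g m *ℚ acc) 1ℚ ns

InW0 : ℚ → Set
InW0 r = Σ (List⁺ ℕ) (λ ns → prodG ns ≡ r)

{-# OPTIONS --safe #-}

-- Write g(n) = a/b with a = 3n+2, b = 2n+1, so that 2a = 3b + 1. For indices n₁ … n_k,
-- 2^k ∏ aᵢ = 3^k ∏ bᵢ + E with 0 < E ≤ k 4^k ∏ bᵢ / (2m+1), m the smallest index.
-- If ∏ g(nᵢ) = p/q, then 2^k p − 3^k q is a positive integer: hence (3/2)^k < p/q, which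
-- bounds k by 2p, and E ≥ ∏ bᵢ / q, which bounds m by k 4^k q. Removing the factor g(m)
-- leaves k − 1 generators with product p(2m+1) / (q(3m+2)), so a bounded search recursing
-- on k decides membership and produces the factorisation.
module Submission where

open import Defs
open import Data.Rational using (ℚ; Positive)
open import Relation.Nullary using (Dec)

open import Data.Integer as ℤ using (+_; -[1+_])
import Data.Integer.Properties as ℤ
open import Data.List using (List; []; _∷_; _++_; length; map; foldr)
open import Data.List.Extrema.Nat using (min; min≤⊤; min≤xs; argmin-sel)
open import Data.List.Membership.Propositional using (_∈_)
open import Data.List.Membership.Propositional.Properties using (∈-∃++)
import Data.List.NonEmpty as List⁺
open import Data.List.Relation.Binary.Permutation.Propositional using (_↭_)
open import Data.List.Relation.Binary.Permutation.Propositional.Properties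
  using (↭-length; shift; map⁺)
open import Data.List.Relation.Unary.All as All using (All)
open import Data.List.Relation.Unary.Any using (here; there)
open import Data.Nat
  using (ℕ; zero; suc; _+_; _*_; _^_; _≤_; _<_; z≤n; s≤s; z<s; NonZero; ≢-nonZero; >-nonZero⁻¹)
open import Data.Nat.ListAction using (product)
open import Data.Nat.ListAction.Properties using (product-↭)
open import Data.Nat.Properties
open import Algebra.Properties.CommutativeSemigroup *-commutativeSemigroup
  using (x∙yz≈y∙xz; xy∙z≈xz∙y; xy∙z≈y∙zx)
open import Data.Nat.Tactic.RingSolver using (solve; solve-∀)
open import Data.Product using (∃-syntax; _×_; _,_)
open import Data.Rational as ℚ using (mkℚ; ↥_; ↧ₙ_; toℚᵘ) renaming (_*_ to _*ℚ_)
import Data.Rational.Properties as ℚ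
open import Data.Rational.Unnormalised as ℚᵘ using (ℚᵘ; mkℚᵘ; _≃_; *≡*)
import Data.Rational.Unnormalised.Properties as ℚᵘ
open import Data.Sum using ([_,_]′)
open import Function using (id; _⇔_; mk⇔; Equivalence)
import Function.Properties.Equivalence as ⇔
open import Relation.Binary.PropositionalEquality
open import Relation.Nullary.Decidable as Dec using (map′)

num den : ℕ → ℕ
num n = 3 * n + 2
den n = suc (2 * n)

n<den : ∀ n → n < den n
n<den n = s≤s (m≤n*m n 2)

num-nonZero : ∀ n → NonZero (num n)
num-nonZero n = ≢-nonZero (m+1+n≢0 (3 * n))

2*num≡3*den+1 : ∀ n → 2 * num n ≡ 3 * den n + 1
2*num≡3*den+1 n = identity n
  where
  identity : ∀ n → 2 * (3 * n + 2) ≡ 3 * (1 + 2 * n) + 1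
  identity = solve-∀

2*num≤4*den : ∀ n → 2 * num n ≤ 4 * den n
2*num≤4*den n = begin
  2 * num n          ≡⟨ 2*num≡3*den+1 n ⟩
  3 * den n + 1      ≤⟨ +-monoʳ-≤ (3 * den n) (s≤s z≤n) ⟩
  3 * den n + den n  ≡⟨ +-comm (3 * den n) (den n) ⟩
  4 * den n          ∎
  where open ≤-Reasoning

∏num ∏den : List ℕ → ℕ
∏num ns = product (map num ns)
∏den ns = product (map den ns)

∏den-nonZero : ∀ ns → NonZero (∏den ns)
∏den-nonZero []       = _
∏den-nonZero (n ∷ ns) = m*n≢0 (den n) (∏den ns) {{_}} {{∏den-nonZero ns}}

excess : List ℕ → ℕ
excess []       = 0
excess (n ∷ ns) = 3 ^ length ns * ∏den ns + 2 * num n * excess ns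

2^k*∏num≡3^k*∏den+excess : ∀ ns → 2 ^ length ns * ∏num ns ≡ 3 ^ length ns * ∏den ns + excess ns
2^k*∏num≡3^k*∏den+excess []       = refl
2^k*∏num≡3^k*∏den+excess (n ∷ ns) =
  step (num n) (den n) (2 ^ length ns) (∏num ns) (3 ^ length ns) (∏den ns) (excess ns)
       (2*num≡3*den+1 n) (2^k*∏num≡3^k*∏den+excess ns)
  where
  step : ∀ a b x y t q e → 2 * a ≡ 3 * b + 1 → x * y ≡ t * q + e →
         2 * x * (a * y) ≡ 3 * t * (b * q) + (t * q + 2 * a * e)
  step a b x y t q e 2a≡3b+1 ih = begin
    2 * x * (a * y)                    ≡⟨ solve (x ∷ a ∷ y ∷ []) ⟩
    2 * a * (x * y)                    ≡⟨ cong (2 * a *_) ih ⟩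
    2 * a * (t * q + e)                ≡⟨ solve (a ∷ t ∷ q ∷ e ∷ []) ⟩
    2 * a * (t * q) + 2 * a * e        ≡⟨ cong (λ c → c * (t * q) + 2 * a * e) 2a≡3b+1 ⟩
    (3 * b + 1) * (t * q) + 2 * a * e  ≡⟨ solve (a ∷ b ∷ t ∷ q ∷ e ∷ []) ⟩
    3 * t * (b * q) + (t * q + 2 * a * e) ∎
    where open ≡-Reasoning

excess-positive : ∀ ns .{{_ : NonZero (length ns)}} → 0 < excess ns
excess-positive (n ∷ ns) = <-≤-trans (m^n>0 3 (length ns)) (begin
  3 ^ length ns                                       ≤⟨ m≤m*n (3 ^ length ns) (∏den ns) {{∏den-nonZero ns}} ⟩
  3 ^ length ns * ∏den ns                             ≤⟨ m≤m+n _ _ ⟩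
  3 ^ length ns * ∏den ns + 2 * num n * excess ns     ∎)
  where open ≤-Reasoning

excess-bound : ∀ {m} ns → All (m ≤_) ns → den m * excess ns ≤ length ns * 4 ^ length ns * ∏den ns
excess-bound {m} [] _ = ≤-reflexive (*-zeroʳ (den m))
excess-bound {m} (n ∷ ns) m≤ =
  step (den m) (den n) (num n) (3 ^ length ns) (4 ^ length ns) (length ns) (∏den ns) (excess ns)
       (s≤s (*-monoʳ-≤ 2 (All.head m≤))) (^-monoˡ-≤ (length ns) (n≤1+n 3)) (2*num≤4*den n)
       (excess-bound ns (All.tail m≤))
  where
  step : ∀ x y a t f k q e → x ≤ y → t ≤ f → 2 * a ≤ 4 * y → x * e ≤ k * f * q →
         x * (t * q + 2 * a * e) ≤ (1 + k) * (4 * f) * (y * q)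
  step x y a t f k q e x≤y t≤f 2a≤4y ih = begin
    x * (t * q + 2 * a * e)                 ≡⟨ solve (x ∷ t ∷ q ∷ a ∷ e ∷ []) ⟩
    x * t * q + 2 * a * (x * e)             ≤⟨ +-mono-≤ (*-monoˡ-≤ q (*-mono-≤ x≤y t≤f)) (*-mono-≤ 2a≤4y ih) ⟩
    y * f * q + 4 * y * (k * f * q)         ≤⟨ +-monoˡ-≤ _ (m≤n*m (y * f * q) 4) ⟩
    4 * (y * f * q) + 4 * y * (k * f * q)   ≡⟨ solve (y ∷ f ∷ q ∷ k ∷ []) ⟩
    (1 + k) * (4 * f) * (y * q)             ∎
    where open ≤-Reasoning

2^n*[n+2]≤2*3^n : ∀ n → 2 ^ n * (n + 2) ≤ 2 * 3 ^ n
2^n*[n+2]≤2*3^n zero    = ≤-refl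
2^n*[n+2]≤2*3^n (suc n) = step (2 ^ n) (3 ^ n) (2^n*[n+2]≤2*3^n n) (^-monoˡ-≤ n (n≤1+n 2))
  where
  step : ∀ a t → a * (n + 2) ≤ 2 * t → a ≤ t → 2 * a * (1 + n + 2) ≤ 2 * (3 * t)
  step a t ih a≤t = begin
    2 * a * (1 + n + 2)        ≡⟨ solve (a ∷ n ∷ []) ⟩
    2 * (a * (n + 2)) + 2 * a  ≤⟨ +-mono-≤ (*-monoʳ-≤ 2 ih) (*-monoʳ-≤ 2 a≤t) ⟩
    2 * (2 * t) + 2 * t        ≡⟨ solve (t ∷ []) ⟩
    2 * (3 * t)                ∎
    where open ≤-Reasoning

Represents : ℕ → ℕ → List ℕ → Set
Represents p q ns = ∏num ns * q ≡ p * ∏den ns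

module _ (p q : ℕ) .{{_ : NonZero q}} (ns : List ℕ) (rep : Represents p q ns) where

  2^k*p*∏den≡3^k*q*∏den+excess*q :
    2 ^ length ns * p * ∏den ns ≡ 3 ^ length ns * q * ∏den ns + excess ns * q
  2^k*p*∏den≡3^k*q*∏den+excess*q =
    step (2 ^ length ns) (∏num ns) (3 ^ length ns) (∏den ns) (excess ns)
         rep (2^k*∏num≡3^k*∏den+excess ns)
    where
    step : ∀ a x t y e → x * q ≡ p * y → a * x ≡ t * y + e → a * p * y ≡ t * q * y + e * q
    step a x t y e xq≡py ax≡ty+e = begin
      a * p * y          ≡⟨ *-assoc a p y ⟩
      a * (p * y)        ≡⟨ cong (a *_) (sym xq≡py) ⟩
      a * (x * q)        ≡⟨ *-assoc a x q ⟨
      a * x * q          ≡⟨ cong (_* q) ax≡ty+e ⟩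
      (t * y + e) * q    ≡⟨ solve (t ∷ y ∷ e ∷ q ∷ []) ⟩
      t * q * y + e * q  ∎
      where open ≡-Reasoning

  module _ .{{_ : NonZero (length ns)}} where

    3^k*q<2^k*p : 3 ^ length ns * q < 2 ^ length ns * p
    3^k*q<2^k*p = *-cancelʳ-< (∏den ns) _ _ (begin-strict
      3 ^ length ns * q * ∏den ns                   <⟨ m<m+n _ (*-mono-< (excess-positive ns) (>-nonZero⁻¹ q)) ⟩
      3 ^ length ns * q * ∏den ns + excess ns * q   ≡⟨ 2^k*p*∏den≡3^k*q*∏den+excess*q ⟨
      2 ^ length ns * p * ∏den ns                   ∎)
      where open ≤-Reasoning

    ∏den≤excess*q : ∏den ns ≤ excess ns * q
    ∏den≤excess*q = +-cancelˡ-≤ (3 ^ length ns * q * ∏den ns) _ _ (begin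
      3 ^ length ns * q * ∏den ns + ∏den ns         ≡⟨ +-comm _ (∏den ns) ⟩
      suc (3 ^ length ns * q) * ∏den ns             ≤⟨ *-monoˡ-≤ (∏den ns) 3^k*q<2^k*p ⟩
      2 ^ length ns * p * ∏den ns                   ≡⟨ 2^k*p*∏den≡3^k*q*∏den+excess*q ⟩
      3 ^ length ns * q * ∏den ns + excess ns * q   ∎)
      where open ≤-Reasoning

    length<2*p : length ns < 2 * p
    length<2*p = <-trans (m<m+n (length ns) {2} z<s) (*-cancelˡ-< (2 ^ length ns) _ _ (begin-strict
      2 ^ length ns * (length ns + 2)   ≤⟨ 2^n*[n+2]≤2*3^n (length ns) ⟩
      2 * 3 ^ length ns                 ≤⟨ *-monoʳ-≤ 2 (m≤m*n (3 ^ length ns) q) ⟩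
      2 * (3 ^ length ns * q)           <⟨ *-monoʳ-< 2 3^k*q<2^k*p ⟩
      2 * (2 ^ length ns * p)           ≡⟨ x∙yz≈y∙xz 2 (2 ^ length ns) p ⟩
      2 ^ length ns * (2 * p)           ∎))
      where open ≤-Reasoning

    minimum-bound : ∀ {m} → All (m ≤_) ns → m < length ns * 4 ^ length ns * q
    minimum-bound {m} m≤ns = <-≤-trans (n<den m) (*-cancelʳ-≤ (den m) _ (∏den ns) {{∏den-nonZero ns}} (begin
      den m * ∏den ns                           ≤⟨ *-monoʳ-≤ (den m) ∏den≤excess*q ⟩
      den m * (excess ns * q)                   ≡⟨ *-assoc (den m) (excess ns) q ⟨
      den m * excess ns * q                     ≤⟨ *-monoˡ-≤ q (excess-bound ns m≤ns) ⟩
      length ns * 4 ^ length ns * ∏den ns * q   ≡⟨ xy∙z≈xz∙y (length ns * 4 ^ length ns) (∏den ns) q ⟩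
      length ns * 4 ^ length ns * q * ∏den ns   ∎))
      where open ≤-Reasoning

represents-∷ : ∀ p q m ns → Represents p q (m ∷ ns) ⇔ Represents (p * den m) (q * num m) ns
represents-∷ p q m ns = mk⇔
  (λ e → trans (sym lhs) (trans e rhs))
  (λ e → trans lhs (trans e (sym rhs)))
  where
  lhs : num m * ∏num ns * q ≡ ∏num ns * (q * num m)
  lhs = xy∙z≈y∙zx (num m) (∏num ns) q
  rhs : p * (den m * ∏den ns) ≡ p * den m * ∏den ns
  rhs = sym (*-assoc p (den m) (∏den ns))

∏-↭ : ∀ (f : ℕ → ℕ) {ns ms} → ns ↭ ms → product (map f ns) ≡ product (map f ms)
∏-↭ f ns↭ms = product-↭ (map⁺ f ns↭ms)

represents-↭ : ∀ p q {ns ms} → ns ↭ ms → Represents p q ns → Represents p q ms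
represents-↭ p q ns↭ms = subst₂ (λ x y → x * q ≡ p * y) (∏-↭ num ns↭ms) (∏-↭ den ns↭ms)

∈⇒↭∷ : ∀ {A : Set} {x : A} {xs} → x ∈ xs → ∃[ ys ] xs ↭ x ∷ ys
∈⇒↭∷ x∈xs with ys , zs , refl ← ∈-∃++ x∈xs = ys ++ zs , shift _ ys zs

min∈ : ∀ n ns → min n ns ∈ n ∷ ns
min∈ n ns = [ here , there ]′ (argmin-sel id n ns)

record Factorisation (k p q : ℕ) : Set where
  constructor factorisation
  field
    factors    : List ℕ
    length≡    : length factors ≡ k
    represents : Represents p q factors

factorisation-∷ : ∀ {k p q} m → Factorisation k (p * den m) (q * num m) → Factorisation (suc k) p q
factorisation-∷ {p = p} {q} m (factorisation ns refl rep) =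
  factorisation (m ∷ ns) refl (Equivalence.from (represents-∷ p q m ns) rep)

factorisation-split-min : ∀ {k p q} .{{_ : NonZero q}} → Factorisation (suc k) p q →
  ∃[ m ] m < suc k * 4 ^ suc k * q × Factorisation k (p * den m) (q * num m)
factorisation-split-min {p = p} {q} (factorisation (n ∷ ns) refl rep)
  with rest , ns↭m∷rest ← ∈⇒↭∷ (min∈ n ns) =
  min n ns ,
  minimum-bound p q (n ∷ ns) rep (min≤⊤ n ns All.∷ min≤xs n ns) ,
  factorisation rest (sym (suc-injective (↭-length ns↭m∷rest)))
    (Equivalence.to (represents-∷ p q (min n ns) rest) (represents-↭ p q ns↭m∷rest rep))

factorisation? : ∀ k p q .{{_ : NonZero q}} → Dec (Factorisation k p q)
factorisation? zero    p q = map′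
  (λ q≡p → factorisation [] refl q≡p)
  (λ { (factorisation [] refl q≡p) → q≡p })
  (1 * q ≟ p * 1)
factorisation? (suc k) p q {{q≢0}} = map′
  (λ (m , _ , f) → factorisation-∷ m f)
  factorisation-split-min
  (anyUpTo? (λ m → factorisation? k (p * den m) (q * num m) {{m*n≢0 q (num m) {{q≢0}} {{num-nonZero m}}}})
            (suc k * 4 ^ suc k * q))

∏g : List ℕ → ℚ
∏g = foldr (λ n r → g n *ℚ r) ℚ.1ℚ

-- g n is by definition the normalisation fromℚᵘ (gᵘ n).
gᵘ : ℕ → ℚᵘ
gᵘ n = mkℚᵘ (+ num n) (2 * n)

∏gᵘ : List ℕ → ℚᵘ
∏gᵘ = foldr (λ n x → gᵘ n ℚᵘ.* x) ℚᵘ.1ℚᵘ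

toℚᵘ-∏g : ∀ ns → toℚᵘ (∏g ns) ≃ ∏gᵘ ns
toℚᵘ-∏g []       = ℚᵘ.≃-refl
toℚᵘ-∏g (n ∷ ns) = ℚᵘ.≃-trans (ℚ.toℚᵘ-homo-* (g n) (∏g ns))
                              (ℚᵘ.*-cong (ℚ.toℚᵘ-fromℚᵘ (gᵘ n)) (toℚᵘ-∏g ns))

↥-* : ∀ x y → ℚᵘ.↥ (x ℚᵘ.* y) ≡ ℚᵘ.↥ x ℤ.* ℚᵘ.↥ y
↥-* (mkℚᵘ _ _) (mkℚᵘ _ _) = refl

↧-* : ∀ x y → ℚᵘ.↧ (x ℚᵘ.* y) ≡ ℚᵘ.↧ x ℤ.* ℚᵘ.↧ y
↧-* (mkℚᵘ _ _) (mkℚᵘ _ _) = refl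

↥∏gᵘ : ∀ ns → ℚᵘ.↥ ∏gᵘ ns ≡ + ∏num ns
↥∏gᵘ []       = refl
↥∏gᵘ (n ∷ ns) = begin
  ℚᵘ.↥ (gᵘ n ℚᵘ.* ∏gᵘ ns)   ≡⟨ ↥-* (gᵘ n) (∏gᵘ ns) ⟩
  + num n ℤ.* ℚᵘ.↥ ∏gᵘ ns   ≡⟨ cong (+ num n ℤ.*_) (↥∏gᵘ ns) ⟩
  + num n ℤ.* + ∏num ns     ≡⟨ ℤ.pos-* (num n) (∏num ns) ⟨
  + ∏num (n ∷ ns)           ∎
  where open ≡-Reasoning

↧∏gᵘ : ∀ ns → ℚᵘ.↧ ∏gᵘ ns ≡ + ∏den ns
↧∏gᵘ []       = refl
↧∏gᵘ (n ∷ ns) = begin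
  ℚᵘ.↧ (gᵘ n ℚᵘ.* ∏gᵘ ns)   ≡⟨ ↧-* (gᵘ n) (∏gᵘ ns) ⟩
  + den n ℤ.* ℚᵘ.↧ ∏gᵘ ns   ≡⟨ cong (+ den n ℤ.*_) (↧∏gᵘ ns) ⟩
  + den n ℤ.* + ∏den ns     ≡⟨ ℤ.pos-* (den n) (∏den ns) ⟨
  + ∏den (n ∷ ns)           ∎
  where open ≡-Reasoning

∏gᵘ≃⇔represents : ∀ {p} ns x → ℚᵘ.↥ x ≡ + p → (∏gᵘ ns ≃ x ⇔ Represents p (ℚᵘ.↧ₙ x) ns)
∏gᵘ≃⇔represents {p} ns x ↥x≡p = mk⇔
  (λ { (*≡* e) → ℤ.+-injective (trans (sym lhs) (trans e rhs)) })
  (λ e → *≡* (trans lhs (trans (cong +_ e) (sym rhs))))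
  where
  lhs : ℚᵘ.↥ ∏gᵘ ns ℤ.* ℚᵘ.↧ x ≡ + (∏num ns * ℚᵘ.↧ₙ x)
  lhs = trans (cong (ℤ._* ℚᵘ.↧ x) (↥∏gᵘ ns)) (sym (ℤ.pos-* (∏num ns) (ℚᵘ.↧ₙ x)))
  rhs : ℚᵘ.↥ x ℤ.* ℚᵘ.↧ ∏gᵘ ns ≡ + (p * ∏den ns)
  rhs = trans (cong₂ ℤ._*_ ↥x≡p (↧∏gᵘ ns)) (sym (ℤ.pos-* p (∏den ns)))

∏g≡⇔∏gᵘ≃ : ∀ ns r → ∏g ns ≡ r ⇔ ∏gᵘ ns ≃ toℚᵘ r
∏g≡⇔∏gᵘ≃ ns r = mk⇔
  (λ e → ℚᵘ.≃-trans (ℚᵘ.≃-sym (toℚᵘ-∏g ns)) (ℚ.toℚᵘ-cong e))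
  (λ e → ℚ.toℚᵘ-injective (ℚᵘ.≃-trans (toℚᵘ-∏g ns) e))

∏g≡⇔represents : ∀ {p} ns r → ↥ r ≡ + p → (∏g ns ≡ r ⇔ Represents p (↧ₙ r) ns)
∏g≡⇔represents ns r@(mkℚ _ _ _) ↥r≡p = ⇔.trans (∏g≡⇔∏gᵘ≃ ns r) (∏gᵘ≃⇔represents ns (toℚᵘ r) ↥r≡p)

bounded-factorisation⇔InW0 : ∀ {p} r → ↥ r ≡ + p →
  (∃[ k ] k < 2 * p × Factorisation (suc k) p (↧ₙ r)) ⇔ InW0 r
bounded-factorisation⇔InW0 {p} r ↥r≡p = mk⇔
  (λ { (_ , _ , factorisation (n ∷ ns) _ rep) → n List⁺.∷ ns , Equivalence.from (⇔rep n ns) rep })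
  (λ { (n List⁺.∷ ns , e) → let rep = Equivalence.to (⇔rep n ns) e in
         length ns , <-trans (n<1+n _) (length<2*p p (↧ₙ r) (n ∷ ns) rep) , factorisation (n ∷ ns) refl rep })
  where
  ⇔rep : ∀ n ns → ∏g (n ∷ ns) ≡ r ⇔ Represents p (↧ₙ r) (n ∷ ns)
  ⇔rep n ns = ∏g≡⇔represents (n ∷ ns) r ↥r≡p

theorem2p1 : (r : ℚ) → Positive r → Dec (InW0 r)
theorem2p1 r@(mkℚ (+ p) _ _) _ =
  Dec.map (bounded-factorisation⇔InW0 r refl)
          (anyUpTo? (λ k → factorisation? (suc k) p (↧ₙ r)) (2 * p))
theorem2p1 (mkℚ -[1+ _ ] _ _) ()
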